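{- For every normal context $C[\ ]$ and all $M,N\in\Lambda$: if $\langle C[\ ], M^\bullet\rangle \rightsquigarrow^* \underline{N}$, then $N\in\mathrm{NF}$.
   Context: $\Lambda$ is the set of untyped $\lambda$-terms and $\mathrm{NF}$ the set of $\lambda$-terms in $\beta$-normal form. A context $C[\ ]$ is a $\lambda$-term with exactly one hole $[\ ]$; $C[M]$ is the result of placing $M$ in the hole (variables may be captured). A context $C[\ ]$ is normal iff $C[M]\in\mathrm{NF}$ for every $M\in\mathrm{NF}$. For every $\lambda$-term $M$ there is a new constant symbol $\underline{M}$, called an atom; atoms have no free variables and substitution leaves an atom unchanged. Terms may be built from variables, atoms, application and abstraction, with substitution and free variables extended accordingly. For $M\in\Lambda$, $M^\bullet$ is the result of replacing each free variable $x$ of $M$ in $M$ by $\underline{x}$; $\Lambda^\bullet=\{M^\bullet\mid M\in\Lambda\}$. Write $M\ \vec N$ for $M\ N_1\cdots N_n$ with $n\ge 0$. $\Lambda^{\mathrm{rb}}$ is the smallest set such that: $\underline{M}\in\Lambda^{\mathrm{rb}}$ for every $M\in\Lambda$; $\langle C[\ ], M\rangle \in \Lambda^{\mathrm{rb}}$ for every context $C[\ ]$ and $M\in\Lambda^\bullet$; $\langle C[\ ], M\ \vec N\rangle\in\Lambda^{\mathrm{rb}}$ for every context $C[\ ]$, $M\in\Lambda^{\mathrm{rb}}$ and $\vec N\in\Lambda^\bullet$ (formal application). The reduction $\rightsquigarrow$ on $\Lambda^{\mathrm{rb}}$ is the smallest relation with: (1) $\langle C[\ ], \underline{M}\rangle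 \rightsquigarrow \underline{C[M]}$ for $M\in\Lambda$; (2) $\langle C[\ ], \lambda x.M\rangle \rightsquigarrow \langle C[\lambda x.[\ ]], M[x:=\underline{x}]\rangle$ for $\lambda x.M\in\Lambda^\bullet$; (3) $\langle C[\ ], \underline{M}\ N_0\ \vec N\rangle \rightsquigarrow \langle C[\ ], \langle M\ [\ ], N_0\rangle\ \vec N\rangle$ for $M\in\Lambda$, $N_0,\vec N\in\Lambda^\bullet$; (4) $\langle C[\ ], (\lambda x.M)\ N_0\ \vec N\rangle\rightsquigarrow\langle C[\ ], M[x:=N_0]\ \vec N\rangle$ for $\lambda x.M, N_0,\vec N\in\Lambda^\bullet$; (5) if $M,M'\in\Lambda^{\mathrm{rb}}$, $M\rightsquigarrow M'$ and $\vec N\in\Lambda^\bullet$, then $\langle C[\ ], M\ \vec N\rangle\rightsquigarrow\langle C[\ ], M'\ \vec N\rangle$. $\rightsquigarrow^*$ is the reflexive-transitive closure of $\rightsquigarrow$. -}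

module Defs where

open import Data.Nat using (ℕ; _≡ᵇ_)
open import Data.Bool using (Bool; true; false; if_then_else_)
open import Data.List using (List; []; _∷_; foldl)
open import Data.Bool.ListAction using (any)
open import Data.List.Relation.Unary.All using (All)
open import Data.Product using (Σ)
open import Relation.Binary.PropositionalEquality using (_≡_)
open import Relation.Binary.Construct.Closure.ReflexiveTransitive using (Star)

data Term : Set where
  var : ℕ → Term
  app : Term → Term → Term
  lam : ℕ → Term → Term

mutual
  data Neutral : Term → Set where
    ne-var : ∀ x → Neutral (var x)
    ne-app : ∀ {M N} → Neutral M → NF N → Neutral (app M N)

  data NF : Term → Set where
    nf-ne  : ∀ {M} → Neutral M → NF M
    nf-lam : ∀ x {M} → NF M → NF (lam x M)

-- Contexts with exactly one hole; plugging may capture variables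

data Ctx : Set where
  hole : Ctx
  appL : Ctx → Term → Ctx
  appR : Term → Ctx → Ctx
  lamC : ℕ → Ctx → Ctx

plug : Ctx → Term → Term
plug hole       M = M
plug (appL C N) M = app (plug C M) N
plug (appR N C) M = app N (plug C M)
plug (lamC x C) M = lam x (plug C M)

_∘C_ : Ctx → Ctx → Ctx
hole       ∘C D = D
appL C N   ∘C D = appL (C ∘C D) N
appR N C   ∘C D = appR N (C ∘C D)
lamC x C   ∘C D = lamC x (C ∘C D)

NormalCtx : Ctx → Set
NormalCtx C = ∀ M → NF M → NF (plug C M)

-- Formal application
-- M N₁ ⋯ Nₙ is represented by ordinary (left-nested) application.

data XTerm : Set where
  xvar  : ℕ → XTerm
  atom  : Term → XTerm
  xapp  : XTerm → XTerm → XTerm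
  xlam  : ℕ → XTerm → XTerm
  pair  : Ctx → XTerm → XTerm

apps : XTerm → List XTerm → XTerm
apps = foldl xapp

-- M[x := N]; only ever used with closed N (N ∈ Λ•), so naive
-- substitution is capture-free.  Atoms (and pairs, which are closed
-- objects) are left unchanged.
subst : ℕ → XTerm → XTerm → XTerm
subst x N (xvar y)   = if x ≡ᵇ y then N else xvar y
subst x N (atom M)   = atom M
subst x N (xapp M P) = xapp (subst x N M) (subst x N P)
subst x N (xlam y M) = if x ≡ᵇ y then xlam y M else xlam y (subst x N M)
subst x N (pair C M) = pair C M

-- M• : replace each free variable x of M by x̲
bulletUnder : List ℕ → Term → XTerm
bulletUnder bs (var y)   = if any (λ z → z ≡ᵇ y) bs then xvar y else atom (var y)
bulletUnder bs (app M N) = xapp (bulletUnder bs M) (bulletUnder bs N)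
bulletUnder bs (lam y M) = xlam y (bulletUnder (y ∷ bs) M)

_• : Term → XTerm
M • = bulletUnder [] M

InΛ• : XTerm → Set
InΛ• T = Σ Term (λ M → (M •) ≡ T)

data RB : XTerm → Set where
  rb-atom : ∀ M → RB (atom M)
  rb-pair : ∀ C {M} → InΛ• M → RB (pair C M)
  rb-app  : ∀ C {M Ns} → RB M → All InΛ• Ns → RB (pair C (apps M Ns))

infix 4 _⇝_
data _⇝_ : XTerm → XTerm → Set where
  r1 : ∀ C M → pair C (atom M) ⇝ atom (plug C M)
  r2 : ∀ C x M → InΛ• (xlam x M) →
       pair C (xlam x M) ⇝ pair (C ∘C lamC x hole) (subst x (atom (var x)) M)
  r3 : ∀ C M N₀ Ns → InΛ• N₀ → All InΛ• Ns →
       pair C (apps (atom M) (N₀ ∷ Ns)) ⇝ pair C (apps (pair (appR M hole) N₀) Ns)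
  r4 : ∀ C x M N₀ Ns → InΛ• (xlam x M) → InΛ• N₀ → All InΛ• Ns →
       pair C (apps (xlam x M) (N₀ ∷ Ns)) ⇝ pair C (apps (subst x N₀ M) Ns)
  r5 : ∀ C {M M'} Ns → RB M → RB M' → M ⇝ M' → All InΛ• Ns →
       pair C (apps M Ns) ⇝ pair C (apps M' Ns)

_⇝*_ : XTerm → XTerm → Set
_⇝*_ = Star _⇝_

-- Read-back never creates a redex.  The invariant: every atom is normal,
-- every context is normal, and whatever stands in head position of an
-- application (an atom, or the context of a pair) is even neutral.  The
-- input ⟨C[ ], M•⟩ satisfies it because C[ ] is normal and the atoms of M•
-- are variables, and each rule of ⇝ preserves it; rule (3) because an atom
-- M̲ applied to arguments is neutral, so M [ ] is a neutral context.
module Submission where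

open import Defs
open import Data.Nat using (_≡ᵇ_)
open import Data.Bool using (true; false)
open import Data.List using (List; []; _∷_)
open import Data.Bool.ListAction using (any)
open import Data.List.Relation.Unary.All using (All; []; _∷_)
open import Data.Product using (_×_; _,_)
open import Data.Unit using (⊤; tt)
open import Data.Empty using (⊥)
open import Relation.Binary.PropositionalEquality as ≡ using (_≡_; refl; sym; cong)
open import Relation.Binary.Construct.Closure.ReflexiveTransitive using (ε; _◅_)

data Demand : Set where
  normal neutral : Demand

Satisfies : Demand → Term → Set
Satisfies normal  = NF
Satisfies neutral = Neutral

SatisfiesCtx : Demand → Ctx → Set
SatisfiesCtx d C = ∀ M → NF M → Satisfies d (plug C M)

neutral⇒satisfies : ∀ d {M} → Neutral M → Satisfies d M
neutral⇒satisfies normal  = nf-ne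
neutral⇒satisfies neutral n = n

plug-∘C : ∀ C D M → plug (C ∘C D) M ≡ plug C (plug D M)
plug-∘C hole       D M = refl
plug-∘C (appL C N) D M = cong (λ P → app P N) (plug-∘C C D M)
plug-∘C (appR N C) D M = cong (app N) (plug-∘C C D M)
plug-∘C (lamC x C) D M = cong (lam x) (plug-∘C C D M)

satisfiesCtx-∘lam : ∀ d C x → SatisfiesCtx d C → SatisfiesCtx d (C ∘C lamC x hole)
satisfiesCtx-∘lam d C x sat M nf =
  ≡.subst (Satisfies d) (sym (plug-∘C C (lamC x hole) M)) (sat (lam x M) (nf-lam x nf))

Wf : Demand → XTerm → Set
Wf d (xvar _)   = ⊤
Wf d (atom M)   = Satisfies d M
Wf d (xapp A B) = Wf neutral A × Wf normal B
Wf d (xlam _ A) = Wf normal A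
Wf d (pair C A) = SatisfiesCtx d C × Wf normal A

-- Terms of Λ• and their substitution instances: their atoms are variables.
Pure : XTerm → Set
Pure (xvar _)   = ⊤
Pure (atom M)   = Neutral M
Pure (xapp A B) = Pure A × Pure B
Pure (xlam _ A) = Pure A
Pure (pair _ _) = ⊥

pure⇒wf : ∀ d T → Pure T → Wf d T
pure⇒wf d (xvar _)   _       = tt
pure⇒wf d (atom M)   n       = neutral⇒satisfies d n
pure⇒wf d (xapp A B) (p , q) = pure⇒wf neutral A p , pure⇒wf normal B q
pure⇒wf d (xlam _ A) p       = pure⇒wf normal A p

subst-pure : ∀ x N T → Pure N → Pure T → Pure (subst x N T)
subst-pure x N (xvar y) pN _ with x ≡ᵇ y
... | true  = pN
... | false = tt
subst-pure x N (atom M)   pN pT       = pT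
subst-pure x N (xapp A B) pN (p , q)  = subst-pure x N A pN p , subst-pure x N B pN q
subst-pure x N (xlam y A) pN pA with x ≡ᵇ y
... | true  = pA
... | false = subst-pure x N A pN pA

bulletUnder-pure : ∀ bs M → Pure (bulletUnder bs M)
bulletUnder-pure bs (var y) with any (λ z → z ≡ᵇ y) bs
... | true  = tt
... | false = ne-var y
bulletUnder-pure bs (app M N) = bulletUnder-pure bs M , bulletUnder-pure bs N
bulletUnder-pure bs (lam y M) = bulletUnder-pure (y ∷ bs) M

InΛ•⇒pure : ∀ {T} → InΛ• T → Pure T
InΛ•⇒pure (M , refl) = bulletUnder-pure [] M

InΛ•⇒wf : ∀ d {T} → InΛ• T → Wf d T
InΛ•⇒wf d {T} p = pure⇒wf d T (InΛ•⇒pure p)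

headDemand : Demand → List XTerm → Demand
headDemand d []      = d
headDemand d (_ ∷ _) = neutral

wf-apps⁻ : ∀ d A Ns → Wf d (apps A Ns) → Wf (headDemand d Ns) A × All (Wf normal) Ns
wf-apps⁻ d A []       wf = wf , []
wf-apps⁻ d A (N ∷ Ns) wf with wf-apps⁻ d (xapp A N) Ns wf
... | (wfA , wfN) , wfNs = wfA , wfN ∷ wfNs

wf-apps⁺ : ∀ d A Ns → Wf (headDemand d Ns) A → All (Wf normal) Ns → Wf d (apps A Ns)
wf-apps⁺ d A []       wfA []           = wfA
wf-apps⁺ d A (N ∷ Ns) wfA (wfN ∷ wfNs) = wf-apps⁺ d (xapp A N) Ns (wfA , wfN) wfNs

All-InΛ•⇒wf : ∀ {Ns} → All InΛ• Ns → All (Wf normal) Ns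
All-InΛ•⇒wf []       = []
All-InΛ•⇒wf (p ∷ ps) = InΛ•⇒wf normal p ∷ All-InΛ•⇒wf ps

wf-step : ∀ d {T T'} → Wf d T → T ⇝ T' → Wf d T'
wf-step d (sat , wfM) (r1 C M) = sat M wfM
wf-step d (sat , _) (r2 C x M p) =
  satisfiesCtx-∘lam d C x sat ,
  pure⇒wf normal (subst x (atom (var x)) M) (subst-pure x (atom (var x)) M (ne-var x) (InΛ•⇒pure p))
wf-step d (sat , wf) (r3 C M N₀ Ns p ps) with wf-apps⁻ normal (atom M) (N₀ ∷ Ns) wf
... | neM , _ =
  sat , wf-apps⁺ normal (pair (appR M hole) N₀) Ns
          ((λ _ nf → neutral⇒satisfies (headDemand normal Ns) (ne-app neM nf)) , InΛ•⇒wf normal p)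
          (All-InΛ•⇒wf ps)
wf-step d (sat , _) (r4 C x M N₀ Ns pλ p ps) =
  sat , wf-apps⁺ normal (subst x N₀ M) Ns
          (pure⇒wf (headDemand normal Ns) (subst x N₀ M) (subst-pure x N₀ M (InΛ•⇒pure p) (InΛ•⇒pure pλ)))
          (All-InΛ•⇒wf ps)
wf-step d (sat , wf) (r5 C {M} {M'} Ns _ _ M⇝M' _) with wf-apps⁻ normal M Ns wf
... | wfM , wfNs = sat , wf-apps⁺ normal M' Ns (wf-step (headDemand normal Ns) wfM M⇝M') wfNs

wf-steps : ∀ {T T'} → Wf normal T → T ⇝* T' → Wf normal T'
wf-steps wf ε          = wf
wf-steps wf (s ◅ steps) = wf-steps (wf-step normal wf s) steps

proposition6 : ∀ (C : Ctx) (M N : Term) → NormalCtx C →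
    pair C (M •) ⇝* atom N → NF N
proposition6 C M N normalC steps = wf-steps (normalC , InΛ•⇒wf normal (M , refl)) steps
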